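{- Let $m$ be a positive integer and let $\Phi\subseteq\mathbf{2}^{[m]}$ be a face system with $\#\Phi>0$. Let $\Phi=[A_1,B_1]\,\dot\cup\cdots\dot\cup\,[A_\theta,B_\theta]$ be a partition of $\Phi$ into Boolean intervals, with profile $(\mathsf{p}_{ij})$. Then for every $0\le l\le m$: $f_l(\Phi;m)=\sum_{i,j}\mathsf{p}_{ij}\binom{i}{l-j}$; $\kappa_l(\mathbf{f}(\Phi;m),\mathbf{H}^{\bullet}_m)=\sum_s\binom{m-s}{m-l}\sum_{i,j}\mathsf{p}_{ij}\binom{i}{s-j}$; $\kappa_l(\mathbf{f}(\Phi;m),\mathbf{F}^{\blacktriangle}_m)=(-1)^l\sum_{i,j}\mathsf{p}_{ij}(-1)^{i+j}\binom{j}{l-i}$; $\kappa_l(\mathbf{f}(\Phi;m),\mathbf{H}^{\blacktriangle}_m)=(-1)^{m-l}\sum_s\binom{s}{m-l}\sum_{i,j}\mathsf{p}_{ij}\binom{i}{s-j}$; $\kappa_l(\mathbf{f}(\Phi;m),\mathbf{F}^{\blacktriangledown}_m)=(-1)^{m-l}\sum_{i,j}\mathsf{p}_{ij}(-1)^j\binom{m-i-j}{l-i}$; $\kappa_l(\mathbf{f}(\Phi;m),\mathbf{H}^{\blacktriangledown}_m)=\sum_{i,j}\mathsf{p}_{ij}\binom{i}{m-l-j}$.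
   Context: $[m]=\{1,\dots,m\}$; a face system is any $\Phi\subseteq\mathbf{2}^{[m]}$ (family of subsets of $[m]$), and $\#$ denotes the number of sets in a family. For faces $A\subseteq C\subseteq[m]$ the Boolean interval is $[A,C]=\{B\subseteq[m]:A\subseteq B\subseteq C\}$. For a partition of $\Phi$ into disjoint Boolean intervals $[A_k,B_k]$, $1\le k\le\theta$, its profile is given by $\mathsf{p}_{ij}=\#\{k:|B_k-A_k|=i,\ |A_k|=j\}$ (sums over $i,j$ run over all nonnegative integers, with $\mathsf{p}_{ij}=0$ if no such interval exists; sums over $s$ run over $0,\dots,m$). Binomial coefficients $\binom{a}{b}$ with $a\ge0$ are $0$ when $b<0$ or $b>a$. All vectors are row vectors in $\mathbb{R}^{m+1}$ with components indexed $0,\dots,m$. $f_i(\Phi;m)=\#\{F\in\Phi:|F|=i\}$ and $\mathbf{f}(\Phi;m)=(f_0(\Phi;m),\dots,f_m(\Phi;m))$. Bases of $\mathbb{R}^{m+1}$, each consisting of vectors indexed by $i=0,\dots,m$, with $j$th component given: $\mathbf{H}^{\bullet}_m$: $(-1)^{j-i}\binom{m-i}{j-i}$; $\mathbf{F}^{\blacktriangle}_m$: $\binom{i}{j}$; $\mathbf{H}^{\blacktriangle}_m$: $(-1)^j\binom{m-i}{j}$; $\mathbf{F}^{\blacktriangledown}_m$: $\binom{i}{m-j}$; $\mathbf{H}^{\blacktriangledown}_m$: $\delta_{m-i,j}$. For a basis $\mathfrak{B}=(b_0,\dots,b_m)$ and $w\in\mathbb{R}^{m+1}$, $\kappa_0(w,\mathfrak{B}),\dots,\kappa_m(w,\mathfrak{B})$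 are the unique reals with $\sum_i\kappa_i(w,\mathfrak{B})b_i=w$. -}

module Defs where

open import Data.Nat using (ℕ; zero; suc; _+_; _*_; _∸_; _≤_; _≡ᵇ_)
open import Data.Integer as ℤ using (ℤ; +_; -[1+_])
open import Data.Bool using (Bool; true; false; if_then_else_; _∧_)
open import Data.Fin using (Fin)
open import Data.Fin.Subset using (Subset; _⊆_; _─_; ∣_∣; inside; outside)
open import Data.Vec using (Vec; []; _∷_)
open import Data.List using (List; []; _∷_; map; _++_; length; filter; upTo; allFin)
import Data.List as L
open import Relation.Nullary.Decidable using (⌊_⌋)
open import Relation.Binary.PropositionalEquality using (_≡_)
open import Data.Product using (_×_; ∃)

binom : ℕ → ℕ → ℕ
binom _       zero    = 1
binom zero    (suc b) = 0
binom (suc a) (suc b) = binom a b + binom a (suc b)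

-- For a negative top argument the value 0 is a junk convention; such
-- terms only ever occur multiplied by a vanishing profile entry.
binomℤ : ℤ → ℤ → ℤ
binomℤ (+ a)    (+ b)    = + binom a b
binomℤ (+ a)    -[1+ _ ] = + 0
binomℤ -[1+ _ ] _        = + 0

sgn : ℕ → ℤ
sgn zero          = + 1
sgn (suc zero)    = ℤ.- (+ 1)
sgn (suc (suc n)) = sgn n

Σ≤ : ℕ → (ℕ → ℤ) → ℤ
Σ≤ zero    g = g zero
Σ≤ (suc n) g = Σ≤ n g ℤ.+ g (suc n)

count : ∀ {A : Set} → (A → Bool) → List A → ℕ
count p xs = length (filter (λ x → p x Data.Bool.≟ true) xs)

allSubsets : (m : ℕ) → List (Subset m)
allSubsets zero    = [] ∷ []
allSubsets (suc m) = map (inside ∷_) (allSubsets m) ++ map (outside ∷_) (allSubsets m)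

FaceSystem : ℕ → Set
FaceSystem m = Subset m → Bool

_∈Φ_ : ∀ {m} → Subset m → FaceSystem m → Set
F ∈Φ Φ = Φ F ≡ true

fvec : ∀ {m} → FaceSystem m → ℕ → ℕ
fvec {m} Φ i = count (λ F → Φ F ∧ (∣ F ∣ ≡ᵇ i)) (allSubsets m)

_∈[_,_] : ∀ {m} → Subset m → Subset m → Subset m → Set
B ∈[ A , C ] = (A ⊆ B) × (B ⊆ C)

record IntervalPartition {m : ℕ} (Φ : FaceSystem m) (θ : ℕ)
                         (A B : Fin θ → Subset m) : Set where
  field
    lower⊆upper : ∀ k → A k ⊆ B k
    cover       : ∀ F → F ∈Φ Φ → ∃ λ k → F ∈[ A k , B k ]
    inside-Φ    : ∀ k F → F ∈[ A k , B k ] → F ∈Φ Φ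
    disjoint    : ∀ k k′ F → F ∈[ A k , B k ] → F ∈[ A k′ , B k′ ] → k ≡ k′

profile : ∀ {m θ} → (A B : Fin θ → Subset m) → ℕ → ℕ → ℕ
profile {θ = θ} A B i j =
  count (λ k → (∣ B k ─ A k ∣ ≡ᵇ i) ∧ (∣ A k ∣ ≡ᵇ j)) (allFin θ)

-- Σ_{i,j} p_ij g(i,j); p_ij = 0 unless i,j ≤ m, so the sum runs over 0..m.
Σp : ∀ {m θ} → (A B : Fin θ → Subset m) → (ℕ → ℕ → ℤ) → ℤ
Σp {m} A B g = Σ≤ m λ i → Σ≤ m λ j → + profile A B i j ℤ.* g i j

-- Bases of R^{m+1}: b i j = j-th component of the i-th basis vector.
Hbullet Ftri Htri Ftriv Htriv : ℕ → ℕ → ℕ → ℤ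
Hbullet m i j = sgn (j ∸ i) ℤ.* binomℤ (+ (m ∸ i)) (+ j ℤ.- + i)
Ftri    m i j = + binom i j
Htri    m i j = sgn j ℤ.* + binom (m ∸ i) j
Ftriv   m i j = binomℤ (+ i) (+ m ℤ.- + j)
Htriv   m i j = if (m ∸ i) ≡ᵇ j then + 1 else + 0

-- c is the coordinate vector κ(w, 𝔅) of w in the basis 𝔅 = (b_0,…,b_m):
-- Σ_i c_i b_i = w (componentwise, components 0..m).
-- Since 𝔅 is a basis, this determines c_0,…,c_m uniquely.
IsCoords : (m : ℕ) → (w : ℕ → ℤ) → (b : ℕ → ℕ → ℤ) → (c : ℕ → ℤ) → Set
IsCoords m w b c = ∀ j → j ≤ m → Σ≤ m (λ i → c i ℤ.* b i j) ≡ w j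

{-# OPTIONS --safe #-}
module Submission where

-- Counting faces by size inside one Boolean interval [A, B] gives C(|B ─ A|, l − |A|), so an
-- interval partition makes f_l(Φ) the profile sum Q l.  In the bases F▲ and F▼ the claimed
-- coordinates are again sums over the intervals, so they only have to be checked for a single
-- interval; substituting l = |A| + t turns that check into the forward-difference identity
-- Σ_t (−1)^(q+t) C(q,t) C(p+t,j) = C(p, j − q).  In the bases H•, H▲ and H▼ the claimed
-- coordinates are a fixed matrix applied to f; after reindexing by m − i that matrix is a left
-- inverse of the basis matrix by binomial inversion Σ_a C(n,a) (−1)^(a+k) C(a,k) = δ_nk.

open import Defs
open import Data.Bool using (Bool; true; false; if_then_else_; _∧_)
open import Data.Bool.Properties using (∧-zeroʳ)
open import Data.Empty using (⊥-elim)
open import Data.Fin using (Fin; zero; suc)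
open import Data.Fin.Properties using (0≢1+n; suc-injective)
open import Data.Fin.Subset using (Subset; _⊆_; _─_; ∣_∣; inside; outside)
open import Data.Fin.Subset.Properties using (_⊆?_; drop-∷-⊆; ∣p∣≤n)
open import Data.Integer as ℤ using (ℤ; +_; -[1+_]; _-_; _*_)
import Data.Integer.Properties as ℤP
open import Data.Integer.Tactic.RingSolver using (solve-∀)
open import Data.List using ([]; _∷_; map; _++_; length; filter; tabulate)
open import Data.List.Properties using (filter-++; length-++)
open import Data.Nat as ℕ using (ℕ; zero; suc; _≤_; _<_; _∸_; _+_; z≤n; s≤s; _≡ᵇ_; _≤?_)
import Data.Nat.Combinatorics as ℕC
import Data.Nat.Properties as ℕP
open import Data.Product using (_×_; _,_; ∃; proj₂)
open import Data.Sum using (inj₁; inj₂)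
open import Data.Vec using ([]; _∷_; here)
open import Function using (_∘_)
open import Relation.Binary.PropositionalEquality
open import Relation.Nullary using (¬_; Dec; does; yes; no)
open import Relation.Nullary.Decidable using (_×-dec_; dec-true; dec-false)

open import Algebra.Properties.Semiring.Sum ℤP.+-*-semiring
  using (sum; sum-syntax; sum-cong-≗; sum-replicate-zero; ∑-distrib-+; *-distribˡ-sum; *-distribʳ-sum)
open ≡-Reasoning

-- Signs and the Kronecker delta

pos-∸ : ∀ {m n} → n ≤ m → + m - + n ≡ + (m ∸ n)
pos-∸ {m} {n} n≤m = trans (ℤP.m-n≡m⊖n m n) (ℤP.⊖-≥ n≤m)

sgn-suc : ∀ n → sgn (suc n) ≡ ℤ.- sgn n
sgn-suc zero          = refl
sgn-suc (suc zero)    = refl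
sgn-suc (suc (suc n)) = sgn-suc n

sgn-+ : ∀ a b → sgn (a + b) ≡ sgn a * sgn b
sgn-+ zero          b = sym (ℤP.*-identityˡ (sgn b))
sgn-+ (suc zero)    b = trans (sgn-suc b) (sym (ℤP.-1*i≡-i (sgn b)))
sgn-+ (suc (suc a)) b = sgn-+ a b

sgn*sgn≡1 : ∀ a → sgn a * sgn a ≡ + 1
sgn*sgn≡1 zero          = refl
sgn*sgn≡1 (suc zero)    = refl
sgn*sgn≡1 (suc (suc a)) = sgn*sgn≡1 a

sgn-cancelˡ : ∀ a x → sgn a * (sgn a * x) ≡ x
sgn-cancelˡ a x = begin
  sgn a * (sgn a * x)   ≡⟨ ℤP.*-assoc (sgn a) (sgn a) x ⟨
  sgn a * sgn a * x     ≡⟨ cong (_* x) (sgn*sgn≡1 a) ⟩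
  + 1 * x               ≡⟨ ℤP.*-identityˡ x ⟩
  x                     ∎

neg*neg : ∀ x y → ℤ.- x * ℤ.- y ≡ x * y
neg*neg = solve-∀

sgn-∸ : ∀ {a b} → b ≤ a → sgn (a ∸ b) ≡ sgn a * sgn b
sgn-∸ {a}     {zero}  _         = sym (ℤP.*-identityʳ (sgn a))
sgn-∸ {suc a} {suc b} (s≤s b≤a) = begin
  sgn (a ∸ b)                 ≡⟨ sgn-∸ b≤a ⟩
  sgn a * sgn b               ≡⟨ neg*neg (sgn a) (sgn b) ⟨
  ℤ.- sgn a * ℤ.- sgn b       ≡⟨ cong₂ _*_ (sgn-suc a) (sgn-suc b) ⟨
  sgn (suc a) * sgn (suc b)   ∎

sgn[p+a]*sgn[p+b]≡sgn[b+a] : ∀ p a b → sgn (p + a) * sgn (p + b) ≡ sgn (b + a)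
sgn[p+a]*sgn[p+b]≡sgn[b+a] zero          a b = trans (ℤP.*-comm (sgn a) (sgn b)) (sym (sgn-+ b a))
sgn[p+a]*sgn[p+b]≡sgn[b+a] (suc zero)    a b =
  trans (cong₂ _*_ (sgn-suc a) (sgn-suc b)) (trans (neg*neg (sgn a) (sgn b)) (sgn[p+a]*sgn[p+b]≡sgn[b+a] 0 a b))
sgn[p+a]*sgn[p+b]≡sgn[b+a] (suc (suc p)) a b = sgn[p+a]*sgn[p+b]≡sgn[b+a] p a b

sgn[q+n∸t]*sgn[q]≡sgn[n+t] : ∀ q n {t} → t ≤ q + n → sgn (q + n ∸ t) * sgn q ≡ sgn (n + t)
sgn[q+n∸t]*sgn[q]≡sgn[n+t] q n {t} t≤q+n = begin
  sgn (q + n ∸ t) * sgn q             ≡⟨ cong (_* sgn q) (trans (sgn-∸ t≤q+n) (cong (_* sgn t) (sgn-+ q n))) ⟩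
  sgn q * sgn n * sgn t * sgn q       ≡⟨ rearrange (sgn q) (sgn n) (sgn t) ⟩
  sgn q * (sgn q * (sgn n * sgn t))   ≡⟨ sgn-cancelˡ q _ ⟩
  sgn n * sgn t                       ≡⟨ sgn-+ n t ⟨
  sgn (n + t)                         ∎
  where
  rearrange : ∀ a b c → a * b * c * a ≡ a * (a * (b * c))
  rearrange = solve-∀

sgn[i+j]≡sgn[m∸i+m∸j] : ∀ {m i j} → i ≤ m → j ≤ m → sgn (i + j) ≡ sgn ((m ∸ i) + (m ∸ j))
sgn[i+j]≡sgn[m∸i+m∸j] {m} {i} {j} i≤m j≤m = begin
  sgn (i + j)                         ≡⟨ sgn-+ i j ⟩
  sgn i * sgn j                       ≡⟨ sgn-cancelˡ m _ ⟨
  sgn m * (sgn m * (sgn i * sgn j))   ≡⟨ rearrange (sgn m) (sgn i) (sgn j) ⟩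
  sgn m * sgn i * (sgn m * sgn j)     ≡⟨ cong₂ _*_ (sgn-∸ i≤m) (sgn-∸ j≤m) ⟨
  sgn (m ∸ i) * sgn (m ∸ j)           ≡⟨ sgn-+ (m ∸ i) (m ∸ j) ⟨
  sgn ((m ∸ i) + (m ∸ j))             ∎
  where
  rearrange : ∀ a b c → a * (a * (b * c)) ≡ a * b * (a * c)
  rearrange = solve-∀

𝟙 : Bool → ℤ
𝟙 b = if b then + 1 else + 0

𝟙-∧ : ∀ a b → 𝟙 (a ∧ b) ≡ 𝟙 a * 𝟙 b
𝟙-∧ true  b = sym (ℤP.*-identityˡ (𝟙 b))
𝟙-∧ false b = sym (ℤP.*-zeroˡ (𝟙 b))

δ : ℕ → ℕ → ℤ
δ s k = 𝟙 (s ≡ᵇ k)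

δ-refl : ∀ n → δ n n ≡ + 1
δ-refl zero    = refl
δ-refl (suc n) = δ-refl n

δ-≢ : ∀ {a b} → a ≢ b → δ a b ≡ + 0
δ-≢ {zero}  {zero}  a≢b = ⊥-elim (a≢b refl)
δ-≢ {zero}  {suc b} _   = refl
δ-≢ {suc a} {zero}  _   = refl
δ-≢ {suc a} {suc b} a≢b = δ-≢ (a≢b ∘ cong suc)

*δ-≢ : ∀ w {s k} → s ≢ k → w * δ s k ≡ + 0
*δ-≢ w s≢k = trans (cong (w *_) (δ-≢ s≢k)) (ℤP.*-zeroʳ w)

δ-sym : ∀ a b → δ a b ≡ δ b a
δ-sym zero    zero    = refl
δ-sym zero    (suc b) = refl
δ-sym (suc a) zero    = refl
δ-sym (suc a) (suc b) = δ-sym a b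

sgn*δ : ∀ n k → sgn n * δ n k ≡ sgn k * δ n k
sgn*δ n k with n ℕ.≟ k
... | yes refl = refl
... | no  n≢k  = trans (*δ-≢ (sgn n) n≢k) (sym (*δ-≢ (sgn k) n≢k))

δ-∸ : ∀ {m s k} → s ≤ m → k ≤ m → δ (m ∸ s) (m ∸ k) ≡ δ s k
δ-∸ {m} {s} {k} s≤m k≤m with s ℕ.≟ k
... | yes refl = trans (δ-refl (m ∸ s)) (sym (δ-refl s))
... | no  s≢k  = trans (δ-≢ (s≢k ∘ ∸-injective)) (sym (δ-≢ s≢k))
  where
  ∸-injective : m ∸ s ≡ m ∸ k → s ≡ k
  ∸-injective e = begin
    s             ≡⟨ ℕP.m∸[m∸n]≡n s≤m ⟨
    m ∸ (m ∸ s)   ≡⟨ cong (m ∸_) e ⟩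
    m ∸ (m ∸ k)   ≡⟨ ℕP.m∸[m∸n]≡n k≤m ⟩
    k             ∎

-- Finite sums

Σ≤-cong : ∀ N {f g : ℕ → ℤ} → (∀ i → i ≤ N → f i ≡ g i) → Σ≤ N f ≡ Σ≤ N g
Σ≤-cong zero    f≡g = f≡g 0 z≤n
Σ≤-cong (suc N) f≡g =
  cong₂ ℤ._+_ (Σ≤-cong N (λ i i≤N → f≡g i (ℕP.m≤n⇒m≤1+n i≤N))) (f≡g (suc N) ℕP.≤-refl)

Σ≤-zero : ∀ N {f : ℕ → ℤ} → (∀ i → i ≤ N → f i ≡ + 0) → Σ≤ N f ≡ + 0
Σ≤-zero zero    f≡0 = f≡0 0 z≤n
Σ≤-zero (suc N) f≡0 =
  cong₂ ℤ._+_ (Σ≤-zero N (λ i i≤N → f≡0 i (ℕP.m≤n⇒m≤1+n i≤N))) (f≡0 (suc N) ℕP.≤-refl)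

Σ≤-+ : ∀ N (f g : ℕ → ℤ) → Σ≤ N (λ i → f i ℤ.+ g i) ≡ Σ≤ N f ℤ.+ Σ≤ N g
Σ≤-+ zero    f g = refl
Σ≤-+ (suc N) f g = trans (cong (ℤ._+ (f (suc N) ℤ.+ g (suc N))) (Σ≤-+ N f g))
                         (interchange (Σ≤ N f) (Σ≤ N g) (f (suc N)) (g (suc N)))
  where
  interchange : ∀ a b c d → (a ℤ.+ b) ℤ.+ (c ℤ.+ d) ≡ (a ℤ.+ c) ℤ.+ (b ℤ.+ d)
  interchange = solve-∀

Σ≤-*ˡ : ∀ N c (f : ℕ → ℤ) → Σ≤ N (λ i → c * f i) ≡ c * Σ≤ N f
Σ≤-*ˡ zero    c f = refl
Σ≤-*ˡ (suc N) c f = trans (cong (ℤ._+ c * f (suc N)) (Σ≤-*ˡ N c f))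
                          (sym (ℤP.*-distribˡ-+ c (Σ≤ N f) (f (suc N))))

Σ≤-*ʳ : ∀ N c (f : ℕ → ℤ) → Σ≤ N (λ i → f i * c) ≡ Σ≤ N f * c
Σ≤-*ʳ N c f = trans (Σ≤-cong N (λ i _ → ℤP.*-comm (f i) c))
                    (trans (Σ≤-*ˡ N c f) (ℤP.*-comm c (Σ≤ N f)))

Σ≤-neg : ∀ N (f : ℕ → ℤ) → Σ≤ N (λ i → ℤ.- f i) ≡ ℤ.- Σ≤ N f
Σ≤-neg N f = trans (Σ≤-cong N (λ i _ → sym (ℤP.-1*i≡-i (f i))))
                   (trans (Σ≤-*ˡ N (ℤ.- + 1) f) (ℤP.-1*i≡-i (Σ≤ N f)))

Σ≤-comm : ∀ N M (f : ℕ → ℕ → ℤ) →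
          Σ≤ N (λ i → Σ≤ M (λ j → f i j)) ≡ Σ≤ M (λ j → Σ≤ N (λ i → f i j))
Σ≤-comm zero    M f = refl
Σ≤-comm (suc N) M f = trans (cong (ℤ._+ Σ≤ M (f (suc N))) (Σ≤-comm N M f))
                            (sym (Σ≤-+ M (λ j → Σ≤ N (λ i → f i j)) (f (suc N))))

Σ≤-∑-comm : ∀ N θ (G : ℕ → Fin θ → ℤ) → Σ≤ N (λ i → ∑[ k < θ ] G i k) ≡ ∑[ k < θ ] Σ≤ N (λ i → G i k)
Σ≤-∑-comm zero    θ G = refl
Σ≤-∑-comm (suc N) θ G = trans (cong (ℤ._+ sum (G (suc N))) (Σ≤-∑-comm N θ G))
                              (sym (∑-distrib-+ (λ k → Σ≤ N (λ i → G i k)) (G (suc N))))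

Σ≤-suc : ∀ N (f : ℕ → ℤ) → Σ≤ (suc N) f ≡ f 0 ℤ.+ Σ≤ N (f ∘ suc)
Σ≤-suc zero    f = refl
Σ≤-suc (suc N) f = trans (cong (ℤ._+ f (suc (suc N))) (Σ≤-suc N f))
                         (ℤP.+-assoc (f 0) (Σ≤ N (f ∘ suc)) (f (suc (suc N))))

Σ≤-reverse : ∀ N (f : ℕ → ℤ) → Σ≤ N (λ i → f (N ∸ i)) ≡ Σ≤ N f
Σ≤-reverse zero    f = refl
Σ≤-reverse (suc N) f = begin
  Σ≤ (suc N) (λ i → f (suc N ∸ i))        ≡⟨ Σ≤-suc N _ ⟩
  f (suc N) ℤ.+ Σ≤ N (λ i → f (N ∸ i))    ≡⟨ cong (λ x → f (suc N) ℤ.+ x) (Σ≤-reverse N f) ⟩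
  f (suc N) ℤ.+ Σ≤ N f                    ≡⟨ ℤP.+-comm (f (suc N)) (Σ≤ N f) ⟩
  Σ≤ (suc N) f                            ∎

Σ≤-from : ∀ {N} p (h : ℕ → ℤ) → p ≤ N → (∀ l → l < p → h l ≡ + 0) →
          Σ≤ N h ≡ Σ≤ (N ∸ p) (λ t → h (p + t))
Σ≤-from         zero    h _         _      = refl
Σ≤-from {suc N} (suc p) h (s≤s p≤N) h<p≡0 = begin
  Σ≤ (suc N) h                               ≡⟨ Σ≤-suc N h ⟩
  h 0 ℤ.+ Σ≤ N (h ∘ suc)                     ≡⟨ cong₂ ℤ._+_ (h<p≡0 0 (s≤s z≤n))
                                                    (Σ≤-from p (h ∘ suc) p≤N (λ l l<p → h<p≡0 (suc l) (s≤s l<p))) ⟩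
  + 0 ℤ.+ Σ≤ (N ∸ p) (λ t → h (suc p + t))   ≡⟨ ℤP.+-identityˡ _ ⟩
  Σ≤ (N ∸ p) (λ t → h (suc p + t))           ∎

Σ≤-δ : ∀ N {k} (w : ℕ → ℤ) → k ≤ N → Σ≤ N (λ s → w s * δ s k) ≡ w k
Σ≤-δ zero    w z≤n = ℤP.*-identityʳ (w 0)
Σ≤-δ (suc N) {k} w k≤1+N with ℕP.m≤n⇒m<n∨m≡n k≤1+N
... | inj₁ k<1+N = begin
  Σ≤ N (λ s → w s * δ s k) ℤ.+ w (suc N) * δ (suc N) k
    ≡⟨ cong₂ ℤ._+_ (Σ≤-δ N w (ℕP.≤-pred k<1+N)) (*δ-≢ (w (suc N)) (ℕP.<⇒≢ k<1+N ∘ sym)) ⟩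
  w k ℤ.+ + 0
    ≡⟨ ℤP.+-identityʳ (w k) ⟩
  w k ∎
... | inj₂ refl = begin
  Σ≤ N (λ s → w s * δ s (suc N)) ℤ.+ w (suc N) * δ (suc N) (suc N)
    ≡⟨ cong₂ ℤ._+_ (Σ≤-zero N (λ s s≤N → *δ-≢ (w s) (ℕP.<⇒≢ (s≤s s≤N))))
                   (trans (cong (w (suc N) *_) (δ-refl N)) (ℤP.*-identityʳ (w (suc N)))) ⟩
  + 0 ℤ.+ w (suc N)
    ≡⟨ ℤP.+-identityˡ (w (suc N)) ⟩
  w (suc N) ∎

Σ≤²-δ : ∀ N (g : ℕ → ℕ → ℤ) {a b} → a ≤ N → b ≤ N →
        Σ≤ N (λ i → Σ≤ N (λ j → g i j * δ j b * δ i a)) ≡ g a b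
Σ≤²-δ N g {a} {b} a≤N b≤N = begin
  Σ≤ N (λ i → Σ≤ N (λ j → g i j * δ j b * δ i a))   ≡⟨ Σ≤-cong N (λ i _ → Σ≤-*ʳ N (δ i a) _) ⟩
  Σ≤ N (λ i → Σ≤ N (λ j → g i j * δ j b) * δ i a)   ≡⟨ Σ≤-cong N (λ i _ → cong (_* δ i a) (Σ≤-δ N (g i) b≤N)) ⟩
  Σ≤ N (λ i → g i b * δ i a)                         ≡⟨ Σ≤-δ N (λ i → g i b) a≤N ⟩
  g a b                                              ∎

Σ≤-pascal : ∀ N n (g : ℕ → ℤ) →
  Σ≤ (suc N) (λ a → + binom (suc n) a * g a)
    ≡ Σ≤ (suc N) (λ a → + binom n a * g a) ℤ.+ Σ≤ N (λ b → + binom n b * g (suc b))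
Σ≤-pascal N n g = begin
  Σ≤ (suc N) (λ a → + binom (suc n) a * g a)
    ≡⟨ Σ≤-suc N _ ⟩
  g₀ ℤ.+ Σ≤ N (λ b → + (binom n b + binom n (suc b)) * g (suc b))
    ≡⟨ cong (λ x → g₀ ℤ.+ x) (trans (Σ≤-cong N (λ b _ → split b)) (Σ≤-+ N _ _)) ⟩
  g₀ ℤ.+ (Σ≤ N (λ b → + binom n b * g (suc b)) ℤ.+ Σ≤ N (λ b → + binom n (suc b) * g (suc b)))
    ≡⟨ rotate g₀ _ _ ⟩
  (g₀ ℤ.+ Σ≤ N (λ b → + binom n (suc b) * g (suc b))) ℤ.+ Σ≤ N (λ b → + binom n b * g (suc b))
    ≡⟨ cong (ℤ._+ Σ≤ N (λ b → + binom n b * g (suc b))) (Σ≤-suc N _) ⟨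
  Σ≤ (suc N) (λ a → + binom n a * g a) ℤ.+ Σ≤ N (λ b → + binom n b * g (suc b)) ∎
  where
  g₀ : ℤ
  g₀ = + 1 * g 0
  split : ∀ b → + (binom n b + binom n (suc b)) * g (suc b)
              ≡ + binom n b * g (suc b) ℤ.+ + binom n (suc b) * g (suc b)
  split b = trans (cong (_* g (suc b)) (ℤP.pos-+ (binom n b) _))
                  (ℤP.*-distribʳ-+ (g (suc b)) (+ binom n b) (+ binom n (suc b)))
  rotate : ∀ a b c → a ℤ.+ (b ℤ.+ c) ≡ (a ℤ.+ c) ℤ.+ b
  rotate = solve-∀

-- Binomial coefficients

binom≡nCk : ∀ n k → binom n k ≡ n ℕC.C k
binom≡nCk n       zero    = refl
binom≡nCk zero    (suc k) = sym (ℕC.k>n⇒nCk≡0 {0} {suc k} (s≤s z≤n))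
binom≡nCk (suc n) (suc k) = trans (cong₂ _+_ (binom≡nCk n k) (binom≡nCk n (suc k)))
                                  (ℕC.nCk+nC[k+1]≡[n+1]C[k+1] n k)

k>n⇒binom≡0 : ∀ {n k} → n < k → binom n k ≡ 0
k>n⇒binom≡0 {n} {k} n<k = trans (binom≡nCk n k) (ℕC.k>n⇒nCk≡0 n<k)

binom-sym : ∀ {n k} → k ≤ n → binom n k ≡ binom n (n ∸ k)
binom-sym {n} {k} k≤n =
  trans (binom≡nCk n k) (trans (ℕC.nCk≡nC[n∸k] k≤n) (sym (binom≡nCk n (n ∸ k))))

binom0≡δ : ∀ a → + binom 0 a ≡ δ a 0
binom0≡δ zero    = refl
binom0≡δ (suc a) = refl

binomℤ-sym : ∀ p x → binomℤ (+ p) x ≡ binomℤ (+ p) (+ p - x)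
binomℤ-sym p -[1+ d ] = sym (cong +_ (k>n⇒binom≡0 (ℕP.m<m+n p (s≤s z≤n))))
binomℤ-sym p (+ k) with k ≤? p
... | yes k≤p = begin
  + binom p k                 ≡⟨ cong +_ (binom-sym k≤p) ⟩
  + binom p (p ∸ k)           ≡⟨ cong (binomℤ (+ p)) (pos-∸ k≤p) ⟨
  binomℤ (+ p) (+ p - + k)    ∎
... | no  k≰p = begin
  + binom p k                              ≡⟨ cong +_ (k>n⇒binom≡0 p<k) ⟩
  binomℤ (+ p) (ℤ.- + suc (k ∸ suc p))     ≡⟨ cong (binomℤ (+ p) ∘ ℤ.-_ ∘ +_) (ℕP.+-∸-assoc 1 p<k) ⟨
  binomℤ (+ p) (ℤ.- + (k ∸ p))             ≡⟨ cong (binomℤ (+ p)) (trans (ℤP.m-n≡m⊖n p k) (ℤP.⊖-< p<k)) ⟨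
  binomℤ (+ p) (+ p - + k)                 ∎
  where p<k = ℕP.≰⇒> k≰p

shiftedBinom : ℕ → ℕ → ℕ → ℕ
shiftedBinom p zero    l       = binom p l
shiftedBinom p (suc q) zero    = 0
shiftedBinom p (suc q) (suc l) = shiftedBinom p q l

binomℤ-shift : ∀ p q l → binomℤ (+ p) (+ l - + q) ≡ + shiftedBinom p q l
binomℤ-shift p zero    l       = cong (binomℤ (+ p)) (ℤP.+-identityʳ (+ l))
binomℤ-shift p (suc q) zero    = refl
binomℤ-shift p (suc q) (suc l) = trans (cong (binomℤ (+ p)) (pos-suc-pos-suc l q)) (binomℤ-shift p q l)
  where
  pos-suc-pos-suc : ∀ a b → + suc a - + suc b ≡ + a - + b
  pos-suc-pos-suc a b = trans (ℤP.m-n≡m⊖n (suc a) (suc b))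
                              (trans (ℤP.[1+m]⊖[1+n]≡m⊖n a b) (sym (ℤP.m-n≡m⊖n a b)))

shiftedBinom-zero : ∀ p q → shiftedBinom (suc p) q 0 ≡ shiftedBinom p q 0
shiftedBinom-zero p zero    = refl
shiftedBinom-zero p (suc q) = refl

shiftedBinom-pascal : ∀ p q l →
  shiftedBinom (suc p) q (suc l) ≡ shiftedBinom p q l + shiftedBinom p q (suc l)
shiftedBinom-pascal p zero    l       = refl
shiftedBinom-pascal p (suc q) zero    = shiftedBinom-zero p q
shiftedBinom-pascal p (suc q) (suc l) = shiftedBinom-pascal p q l

shiftedBinom-suc : ∀ p q l → shiftedBinom (suc p) q l ≡ shiftedBinom p (suc q) l + shiftedBinom p q l
shiftedBinom-suc p q zero    = shiftedBinom-zero p q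
shiftedBinom-suc p q (suc l) = shiftedBinom-pascal p q l

shiftedBinom0≡δ : ∀ q l → + shiftedBinom 0 q l ≡ δ q l
shiftedBinom0≡δ zero    zero    = refl
shiftedBinom0≡δ zero    (suc l) = refl
shiftedBinom0≡δ (suc q) zero    = refl
shiftedBinom0≡δ (suc q) (suc l) = shiftedBinom0≡δ q l

shiftedBinom-< : ∀ p {q l} → l < q → shiftedBinom p q l ≡ 0
shiftedBinom-< p {suc q} {zero}  _         = refl
shiftedBinom-< p {suc q} {suc l} (s≤s l<q) = shiftedBinom-< p l<q

binomℤ-< : ∀ a {l p} → l < p → binomℤ (+ a) (+ l - + p) ≡ + 0
binomℤ-< a {l} {p} l<p = trans (binomℤ-shift a p l) (cong +_ (shiftedBinom-< a l<p))

binomℤ-+ : ∀ a p t → binomℤ (+ a) (+ (p + t) - + p) ≡ + binom a t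
binomℤ-+ a p t = cong (binomℤ (+ a)) (trans (pos-∸ (ℕP.m≤m+n p t)) (cong +_ (ℕP.m+n∸m≡n p t)))

-- The q-th forward difference of t ↦ C(p + t, j) at 0; the induction on q uses
-- Δ^(q+1) f = Δ^q (f ∘ suc) − Δ^q f, where shifting f means replacing p by p + 1.
forwardDifference-binom : ∀ p {q N} j → q ≤ N →
  Σ≤ N (λ t → + binom q t * (sgn (q + t) * + binom (p + t) j)) ≡ + shiftedBinom p q j
forwardDifference-binom p {zero} {N} j _ = begin
  Σ≤ N (λ t → + binom 0 t * (sgn t * + binom (p + t) j))   ≡⟨ Σ≤-cong N (λ t _ → ℤP.*-comm (+ binom 0 t) _) ⟩
  Σ≤ N (λ t → sgn t * + binom (p + t) j * + binom 0 t)     ≡⟨ Σ≤-cong N (λ t _ → cong (sgn t * + binom (p + t) j *_) (binom0≡δ t)) ⟩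
  Σ≤ N (λ t → sgn t * + binom (p + t) j * δ t 0)           ≡⟨ Σ≤-δ N (λ t → sgn t * + binom (p + t) j) z≤n ⟩
  + 1 * + binom (p + 0) j                                  ≡⟨ ℤP.*-identityˡ _ ⟩
  + binom (p + 0) j                                        ≡⟨ cong (λ x → + binom x j) (ℕP.+-identityʳ p) ⟩
  + binom p j                                              ∎
forwardDifference-binom p {suc q} {suc N} j (s≤s q≤N) = begin
  Σ≤ (suc N) (λ t → + binom (suc q) t * g t)
    ≡⟨ Σ≤-pascal N q g ⟩
  Σ≤ (suc N) (λ t → + binom q t * g t) ℤ.+ Σ≤ N (λ t → + binom q t * g (suc t))
    ≡⟨ cong₂ ℤ._+_ unshifted shifted ⟩
  ℤ.- + shiftedBinom p q j ℤ.+ + shiftedBinom (suc p) q j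
    ≡⟨ cong (λ x → ℤ.- + shiftedBinom p q j ℤ.+ x)
            (trans (cong +_ (shiftedBinom-suc p q j)) (ℤP.pos-+ (shiftedBinom p (suc q) j) (shiftedBinom p q j))) ⟩
  ℤ.- + shiftedBinom p q j ℤ.+ (+ shiftedBinom p (suc q) j ℤ.+ + shiftedBinom p q j)
    ≡⟨ cancel (+ shiftedBinom p q j) (+ shiftedBinom p (suc q) j) ⟩
  + shiftedBinom p (suc q) j ∎
  where
  g : ℕ → ℤ
  g t = sgn (suc q + t) * + binom (p + t) j
  cancel : ∀ a b → ℤ.- a ℤ.+ (b ℤ.+ a) ≡ b
  cancel = solve-∀
  neg-inside : ∀ x s y → x * (ℤ.- s * y) ≡ ℤ.- (x * (s * y))
  neg-inside = solve-∀
  unshifted : Σ≤ (suc N) (λ t → + binom q t * g t) ≡ ℤ.- + shiftedBinom p q j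
  unshifted = begin
    Σ≤ (suc N) (λ t → + binom q t * g t)
      ≡⟨ Σ≤-cong (suc N) (λ t _ → trans (cong (λ s → + binom q t * (s * + binom (p + t) j)) (sgn-suc (q + t)))
                                         (neg-inside (+ binom q t) (sgn (q + t)) _)) ⟩
    Σ≤ (suc N) (λ t → ℤ.- (+ binom q t * (sgn (q + t) * + binom (p + t) j)))
      ≡⟨ Σ≤-neg (suc N) _ ⟩
    ℤ.- Σ≤ (suc N) (λ t → + binom q t * (sgn (q + t) * + binom (p + t) j))
      ≡⟨ cong ℤ.-_ (forwardDifference-binom p j (ℕP.m≤n⇒m≤1+n q≤N)) ⟩
    ℤ.- + shiftedBinom p q j ∎
  shifted : Σ≤ N (λ t → + binom q t * g (suc t)) ≡ + shiftedBinom (suc p) q j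
  shifted = trans (Σ≤-cong N (λ t _ → cong₂ (λ x y → + binom q t * (sgn x * + binom y j))
                                             (cong suc (ℕP.+-suc q t)) (ℕP.+-suc p t)))
                  (forwardDifference-binom (suc p) j q≤N)

binomial-inversion : ∀ {n N} k → n ≤ N →
  Σ≤ N (λ a → + binom n a * (sgn (a + k) * + binom a k)) ≡ δ n k
binomial-inversion {n} {N} k n≤N = begin
  Σ≤ N (λ a → + binom n a * (sgn (a + k) * + binom a k))
    ≡⟨ Σ≤-cong N (λ a _ → cong (λ s → + binom n a * (s * + binom a k)) (sign a)) ⟩
  Σ≤ N (λ a → + binom n a * (sgn n * sgn k * sgn (n + a) * + binom a k))
    ≡⟨ Σ≤-cong N (λ a _ → pull (+ binom n a) (sgn n * sgn k) (sgn (n + a)) (+ binom a k)) ⟩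
  Σ≤ N (λ a → sgn n * sgn k * (+ binom n a * (sgn (n + a) * + binom a k)))
    ≡⟨ Σ≤-*ˡ N (sgn n * sgn k) _ ⟩
  sgn n * sgn k * Σ≤ N (λ a → + binom n a * (sgn (n + a) * + binom (0 + a) k))
    ≡⟨ cong (sgn n * sgn k *_) (trans (forwardDifference-binom 0 k n≤N) (shiftedBinom0≡δ n k)) ⟩
  sgn n * sgn k * δ n k
    ≡⟨ ℤP.*-assoc (sgn n) (sgn k) (δ n k) ⟩
  sgn n * (sgn k * δ n k)
    ≡⟨ cong (sgn n *_) (sgn*δ n k) ⟨
  sgn n * (sgn n * δ n k)
    ≡⟨ sgn-cancelˡ n (δ n k) ⟩
  δ n k ∎
  where
  pull : ∀ x c s y → x * (c * s * y) ≡ c * (x * (s * y))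
  pull = solve-∀
  sign : ∀ a → sgn (a + k) ≡ sgn n * sgn k * sgn (n + a)
  sign a = begin
    sgn (a + k)                         ≡⟨ sgn-+ a k ⟩
    sgn a * sgn k                       ≡⟨ sgn-cancelˡ n _ ⟨
    sgn n * (sgn n * (sgn a * sgn k))   ≡⟨ regroup (sgn n) (sgn a) (sgn k) ⟩
    sgn n * sgn k * (sgn n * sgn a)     ≡⟨ cong (sgn n * sgn k *_) (sgn-+ n a) ⟨
    sgn n * sgn k * sgn (n + a)         ∎
    where
    regroup : ∀ c a b → c * (c * (a * b)) ≡ c * b * (c * a)
    regroup = solve-∀

-- Coordinates in the six bases

Σ≤-forwardDifference : ∀ {m p n} (σ : ℕ → ℤ) j → p + n ≤ m →
  (∀ t → t ≤ m ∸ p → σ (p + t) ≡ sgn (n + t)) →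
  Σ≤ m (λ l → σ l * binomℤ (+ n) (+ l - + p) * + binom l j) ≡ + shiftedBinom p n j
Σ≤-forwardDifference {m} {p} {n} σ j p+n≤m σ≡sgn = begin
  Σ≤ m (λ l → σ l * binomℤ (+ n) (+ l - + p) * + binom l j)
    ≡⟨ Σ≤-from p _ (ℕP.m+n≤o⇒m≤o p p+n≤m) below ⟩
  Σ≤ (m ∸ p) (λ t → σ (p + t) * binomℤ (+ n) (+ (p + t) - + p) * + binom (p + t) j)
    ≡⟨ Σ≤-cong (m ∸ p) term ⟩
  Σ≤ (m ∸ p) (λ t → + binom n t * (sgn (n + t) * + binom (p + t) j))
    ≡⟨ forwardDifference-binom p j (subst (_≤ m ∸ p) (ℕP.m+n∸m≡n p n) (ℕP.∸-monoˡ-≤ p p+n≤m)) ⟩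
  + shiftedBinom p n j ∎
  where
  annihilate : ∀ a b → a * + 0 * b ≡ + 0
  annihilate = solve-∀
  rearrange : ∀ s x y → s * x * y ≡ x * (s * y)
  rearrange = solve-∀
  below : ∀ l → l < p → σ l * binomℤ (+ n) (+ l - + p) * + binom l j ≡ + 0
  below l l<p = trans (cong (λ x → σ l * x * + binom l j) (binomℤ-< n l<p)) (annihilate (σ l) (+ binom l j))
  term : ∀ t → t ≤ m ∸ p → σ (p + t) * binomℤ (+ n) (+ (p + t) - + p) * + binom (p + t) j
                           ≡ + binom n t * (sgn (n + t) * + binom (p + t) j)
  term t t≤m∸p = trans (cong₂ (λ s x → s * x * + binom (p + t) j) (σ≡sgn t t≤m∸p) (binomℤ-+ n p t))
                       (rearrange (sgn (n + t)) (+ binom n t) (+ binom (p + t) j))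

-- The f-vector of a Boolean interval [A, B] with p = |B ─ A| and q = |A|.
fInterval : ℕ → ℕ → ℕ → ℤ
fInterval p q j = binomℤ (+ p) (+ j - + q)

Ftri-interval : ∀ {m p q} → p + q ≤ m →
  IsCoords m (fInterval p q) (Ftri m) (λ l → sgn l * (sgn (p + q) * binomℤ (+ q) (+ l - + p)))
Ftri-interval {m} {p} {q} p+q≤m j _ = begin
  Σ≤ m (λ l → sgn l * (sgn (p + q) * binomℤ (+ q) (+ l - + p)) * + binom l j)
    ≡⟨ Σ≤-cong m (λ l _ → cong (_* + binom l j) (ℤP.*-assoc (sgn l) (sgn (p + q)) _)) ⟨
  Σ≤ m (λ l → sgn l * sgn (p + q) * binomℤ (+ q) (+ l - + p) * + binom l j)
    ≡⟨ Σ≤-forwardDifference (λ l → sgn l * sgn (p + q)) j p+q≤m (λ t _ → sgn[p+a]*sgn[p+b]≡sgn[b+a] p t q) ⟩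
  + shiftedBinom p q j
    ≡⟨ binomℤ-shift p q j ⟨
  binomℤ (+ p) (+ j - + q) ∎

Ftriv-interval : ∀ {m p q} → p + q ≤ m →
  IsCoords m (fInterval p q) (Ftriv m) (λ l → sgn (m ∸ l) * (sgn q * binomℤ (+ m - + p - + q) (+ l - + p)))
Ftriv-interval {m} {p} {q} p+q≤m j j≤m with ℕP.m≤n⇒∃[o]m+o≡n p+q≤m
... | n , refl = begin
  Σ≤ m (λ l → sgn (m ∸ l) * (sgn q * binomℤ (+ m - + p - + q) (+ l - + p)) * binomℤ (+ l) (+ m - + j))
    ≡⟨ Σ≤-cong m (λ l _ → cong₂ (λ x y → sgn (m ∸ l) * (sgn q * binomℤ x (+ l - + p)) * binomℤ (+ l) y)
                                 top≡n (pos-∸ j≤m)) ⟩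
  Σ≤ m (λ l → sgn (m ∸ l) * (sgn q * binomℤ (+ n) (+ l - + p)) * + binom l (m ∸ j))
    ≡⟨ Σ≤-cong m (λ l _ → cong (_* + binom l (m ∸ j)) (ℤP.*-assoc (sgn (m ∸ l)) (sgn q) _)) ⟨
  Σ≤ m (λ l → sgn (m ∸ l) * sgn q * binomℤ (+ n) (+ l - + p) * + binom l (m ∸ j))
    ≡⟨ Σ≤-forwardDifference (λ l → sgn (m ∸ l) * sgn q) (m ∸ j) (ℕP.+-monoˡ-≤ n (ℕP.m≤m+n p q)) sign ⟩
  + shiftedBinom p n (m ∸ j)
    ≡⟨ binomℤ-shift p n (m ∸ j) ⟨
  binomℤ (+ p) (+ (m ∸ j) - + n)
    ≡⟨ cong (binomℤ (+ p)) bottom≡ ⟩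
  binomℤ (+ p) (+ p - (+ j - + q))
    ≡⟨ binomℤ-sym p (+ j - + q) ⟨
  binomℤ (+ p) (+ j - + q) ∎
  where
  pos-m : + m ≡ + p ℤ.+ + q ℤ.+ + n
  pos-m = trans (ℤP.pos-+ (p + q) n) (cong (ℤ._+ + n) (ℤP.pos-+ p q))
  cancel : ∀ a b c → a ℤ.+ b ℤ.+ c - a - b ≡ c
  cancel = solve-∀
  top≡n : + m - + p - + q ≡ + n
  top≡n = trans (cong (λ x → x - + p - + q) pos-m) (cancel (+ p) (+ q) (+ n))
  regroup : ∀ a b c d → a ℤ.+ b ℤ.+ c - d - c ≡ a - (d - b)
  regroup = solve-∀
  bottom≡ : + (m ∸ j) - + n ≡ + p - (+ j - + q)
  bottom≡ = trans (cong (_- + n) (trans (sym (pos-∸ j≤m)) (cong (_- + j) pos-m))) (regroup (+ p) (+ q) (+ n) (+ j))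
  m∸p≡q+n : m ∸ p ≡ q + n
  m∸p≡q+n = trans (cong (_∸ p) (ℕP.+-assoc p q n)) (ℕP.m+n∸m≡n p (q + n))
  sign : ∀ t → t ≤ m ∸ p → sgn (m ∸ (p + t)) * sgn q ≡ sgn (n + t)
  sign t t≤m∸p =
    trans (cong (λ x → sgn x * sgn q) (trans (cong (_∸ (p + t)) (ℕP.+-assoc p q n)) (ℕP.[m+n]∸[m+o]≡n∸o p (q + n) t)))
          (sgn[q+n∸t]*sgn[q]≡sgn[n+t] q n (subst (t ≤_) m∸p≡q+n t≤m∸p))

Hbullet-via-binom : ∀ {m i j} → i ≤ m → j ≤ m →
  Hbullet m i j ≡ sgn ((m ∸ i) + (m ∸ j)) * + binom (m ∸ i) (m ∸ j)
Hbullet-via-binom {m} {i} {j} i≤m j≤m = begin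
  sgn (j ∸ i) * binomℤ (+ (m ∸ i)) (+ j - + i)
    ≡⟨ sign ⟩
  sgn (i + j) * binomℤ (+ (m ∸ i)) (+ j - + i)
    ≡⟨ cong₂ _*_ (sgn[i+j]≡sgn[m∸i+m∸j] i≤m j≤m) (binomℤ-sym (m ∸ i) (+ j - + i)) ⟩
  sgn ((m ∸ i) + (m ∸ j)) * binomℤ (+ (m ∸ i)) (+ (m ∸ i) - (+ j - + i))
    ≡⟨ cong (λ x → sgn ((m ∸ i) + (m ∸ j)) * binomℤ (+ (m ∸ i)) x) bottom≡ ⟩
  sgn ((m ∸ i) + (m ∸ j)) * + binom (m ∸ i) (m ∸ j) ∎
  where
  -- For i > j the binomial vanishes, so the truncation in j ∸ i does no harm.
  sign : sgn (j ∸ i) * binomℤ (+ (m ∸ i)) (+ j - + i) ≡ sgn (i + j) * binomℤ (+ (m ∸ i)) (+ j - + i)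
  sign with i ≤? j
  ... | yes i≤j = cong (_* binomℤ (+ (m ∸ i)) (+ j - + i))
                       (trans (sgn-∸ i≤j) (trans (ℤP.*-comm (sgn j) (sgn i)) (sym (sgn-+ i j))))
  ... | no  i≰j = trans (cong (sgn (j ∸ i) *_) vanish)
                        (trans (ℤP.*-zeroʳ (sgn (j ∸ i)))
                               (sym (trans (cong (sgn (i + j) *_) vanish) (ℤP.*-zeroʳ (sgn (i + j))))))
    where
    vanish : binomℤ (+ (m ∸ i)) (+ j - + i) ≡ + 0
    vanish = binomℤ-< (m ∸ i) (ℕP.≰⇒> i≰j)
  regroup : ∀ a b c → a - b - (c - b) ≡ a - c
  regroup = solve-∀
  bottom≡ : + (m ∸ i) - (+ j - + i) ≡ + (m ∸ j)
  bottom≡ = trans (cong (_- (+ j - + i)) (sym (pos-∸ i≤m))) (trans (regroup (+ m) (+ i) (+ j)) (pos-∸ j≤m))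

Hbullet-leftInverse : ∀ {m s j} → s ≤ m → j ≤ m →
  Σ≤ m (λ i → + binom (m ∸ s) (m ∸ i) * Hbullet m i j) ≡ δ s j
Hbullet-leftInverse {m} {s} {j} s≤m j≤m = begin
  Σ≤ m (λ i → + binom (m ∸ s) (m ∸ i) * Hbullet m i j)
    ≡⟨ Σ≤-cong m (λ i i≤m → cong (+ binom (m ∸ s) (m ∸ i) *_) (Hbullet-via-binom i≤m j≤m)) ⟩
  Σ≤ m (λ i → F (m ∸ i))
    ≡⟨ Σ≤-reverse m F ⟩
  Σ≤ m F
    ≡⟨ binomial-inversion (m ∸ j) (ℕP.m∸n≤m m s) ⟩
  δ (m ∸ s) (m ∸ j)
    ≡⟨ δ-∸ s≤m j≤m ⟩
  δ s j ∎
  where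
  F : ℕ → ℤ
  F a = + binom (m ∸ s) a * (sgn (a + (m ∸ j)) * + binom a (m ∸ j))

Htri-leftInverse : ∀ {m s j} → s ≤ m →
  Σ≤ m (λ l → sgn (m ∸ l) * + binom s (m ∸ l) * Htri m l j) ≡ δ s j
Htri-leftInverse {m} {s} {j} s≤m = begin
  Σ≤ m (λ l → F (m ∸ l))
    ≡⟨ Σ≤-reverse m F ⟩
  Σ≤ m F
    ≡⟨ Σ≤-cong m (λ a _ → trans (rearrange (sgn a) (+ binom s a) (sgn j) (+ binom a j))
                                (cong (λ x → + binom s a * (x * + binom a j)) (sym (sgn-+ a j)))) ⟩
  Σ≤ m (λ a → + binom s a * (sgn (a + j) * + binom a j))
    ≡⟨ binomial-inversion j s≤m ⟩
  δ s j ∎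
  where
  F : ℕ → ℤ
  F a = sgn a * + binom s a * (sgn j * + binom a j)
  rearrange : ∀ x c y d → x * c * (y * d) ≡ c * (x * y * d)
  rearrange = solve-∀

IsCoords-cong : ∀ {m w c c′} (b : ℕ → ℕ → ℤ) → (∀ i → i ≤ m → c i ≡ c′ i) →
                IsCoords m w b c → IsCoords m w b c′
IsCoords-cong {m} b c≡c′ coords j j≤m =
  trans (Σ≤-cong m (λ i i≤m → cong (_* b i j) (sym (c≡c′ i i≤m)))) (coords j j≤m)

leftInverse⇒IsCoords : ∀ {m} (w : ℕ → ℤ) (b α : ℕ → ℕ → ℤ) →
  (∀ s j → s ≤ m → j ≤ m → Σ≤ m (λ i → α s i * b i j) ≡ δ s j) →
  IsCoords m w b (λ i → Σ≤ m (λ s → α s i * w s))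
leftInverse⇒IsCoords {m} w b α αb≡δ j j≤m = begin
  Σ≤ m (λ i → Σ≤ m (λ s → α s i * w s) * b i j)     ≡⟨ Σ≤-cong m (λ i _ → Σ≤-*ʳ m (b i j) _) ⟨
  Σ≤ m (λ i → Σ≤ m (λ s → α s i * w s * b i j))     ≡⟨ Σ≤-comm m m _ ⟩
  Σ≤ m (λ s → Σ≤ m (λ i → α s i * w s * b i j))     ≡⟨ Σ≤-cong m (λ s _ → Σ≤-cong m (λ i _ → rearrange (α s i) (w s) (b i j))) ⟩
  Σ≤ m (λ s → Σ≤ m (λ i → w s * (α s i * b i j)))   ≡⟨ Σ≤-cong m (λ s _ → Σ≤-*ˡ m (w s) _) ⟩
  Σ≤ m (λ s → w s * Σ≤ m (λ i → α s i * b i j))     ≡⟨ Σ≤-cong m (λ s s≤m → cong (w s *_) (αb≡δ s j s≤m j≤m)) ⟩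
  Σ≤ m (λ s → w s * δ s j)                          ≡⟨ Σ≤-δ m w j≤m ⟩
  w j                                               ∎
  where
  rearrange : ∀ a x y → a * x * y ≡ x * (a * y)
  rearrange = solve-∀

reversed-IsCoords : ∀ m (w : ℕ → ℤ) → IsCoords m w (Htriv m) (λ l → w (m ∸ l))
reversed-IsCoords m w j j≤m = trans (Σ≤-reverse m (λ a → w a * δ a j)) (Σ≤-δ m w j≤m)

-- Counting faces

count-∷ : ∀ {A : Set} (p : A → Bool) x xs → + count p (x ∷ xs) ≡ 𝟙 (p x) ℤ.+ + count p xs
count-∷ p x xs with p x
... | true  = refl
... | false = refl

count-++ : ∀ {A : Set} (p : A → Bool) xs ys → count p (xs ++ ys) ≡ count p xs + count p ys
count-++ p xs ys = trans (cong length (filter-++ _ xs ys)) (length-++ (filter _ xs))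

count-map : ∀ {A B : Set} (p : B → Bool) (g : A → B) xs → count p (map g xs) ≡ count (p ∘ g) xs
count-map p g []       = refl
count-map p g (x ∷ xs) with p (g x)
... | true  = cong suc (count-map p g xs)
... | false = count-map p g xs

count-none : ∀ {A : Set} (p : A → Bool) → (∀ x → p x ≡ false) → ∀ xs → count p xs ≡ 0
count-none p p≡false []       = refl
count-none p p≡false (x ∷ xs) rewrite p≡false x = count-none p p≡false xs

count-tabulate : ∀ {A : Set} {θ} (p : A → Bool) (f : Fin θ → A) →
                 + count p (tabulate f) ≡ ∑[ k < θ ] 𝟙 (p (f k))
count-tabulate {θ = zero}  p f = refl
count-tabulate {θ = suc θ} p f =
  trans (count-∷ p (f zero) (tabulate (f ∘ suc))) (cong (λ x → 𝟙 (p (f zero)) ℤ.+ x) (count-tabulate p (f ∘ suc)))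

count-∑ : ∀ {A : Set} {θ} (p : A → Bool) (q : Fin θ → A → Bool) →
          (∀ x → 𝟙 (p x) ≡ ∑[ k < θ ] 𝟙 (q k x)) →
          ∀ xs → + count p xs ≡ ∑[ k < θ ] (+ count (q k) xs)
count-∑ {θ = θ} p q 𝟙p≡∑ []       = sym (sum-replicate-zero θ)
count-∑ {θ = θ} p q 𝟙p≡∑ (x ∷ xs) = begin
  + count p (x ∷ xs)                                        ≡⟨ count-∷ p x xs ⟩
  𝟙 (p x) ℤ.+ + count p xs                                  ≡⟨ cong₂ ℤ._+_ (𝟙p≡∑ x) (count-∑ p q 𝟙p≡∑ xs) ⟩
  (∑[ k < θ ] 𝟙 (q k x)) ℤ.+ ∑[ k < θ ] (+ count (q k) xs)  ≡⟨ ∑-distrib-+ (λ k → 𝟙 (q k x)) (λ k → + count (q k) xs) ⟨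
  ∑[ k < θ ] (𝟙 (q k x) ℤ.+ + count (q k) xs)               ≡⟨ sum-cong-≗ (λ k → count-∷ (q k) x xs) ⟨
  ∑[ k < θ ] (+ count (q k) (x ∷ xs))                       ∎

∑-𝟙-none : ∀ {θ} {P : Fin θ → Set} (P? : ∀ k → Dec (P k)) → (∀ k → ¬ P k) →
           ∑[ k < θ ] 𝟙 (does (P? k)) ≡ + 0
∑-𝟙-none {θ} P? ¬P = trans (sum-cong-≗ (λ k → cong 𝟙 (dec-false (P? k) (¬P k)))) (sum-replicate-zero θ)

∑-𝟙-unique : ∀ {θ} {P : Fin θ → Set} (P? : ∀ k → Dec (P k)) {k₀} → P k₀ → (∀ k → P k → k ≡ k₀) →
             ∑[ k < θ ] 𝟙 (does (P? k)) ≡ + 1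
∑-𝟙-unique {suc θ} P? {zero} Pk₀ unique =
  cong₂ ℤ._+_ (cong 𝟙 (dec-true (P? zero) Pk₀))
              (∑-𝟙-none (P? ∘ suc) (λ k Pk → 0≢1+n (sym (unique (suc k) Pk))))
∑-𝟙-unique {suc θ} P? {suc k₀} Pk₀ unique =
  trans (cong₂ ℤ._+_ (cong 𝟙 (dec-false (P? zero) (λ P0 → 0≢1+n (unique zero P0))))
                     (∑-𝟙-unique (P? ∘ suc) Pk₀ (λ k Pk → suc-injective (unique (suc k) Pk))))
        (ℤP.+-identityˡ (+ 1))

count-allSubsets : ∀ {m} (p : Subset (suc m) → Bool) →
  count p (allSubsets (suc m)) ≡ count (p ∘ (inside ∷_)) (allSubsets m) + count (p ∘ (outside ∷_)) (allSubsets m)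
count-allSubsets {m} p = begin
  count p (map (inside ∷_) (allSubsets m) ++ map (outside ∷_) (allSubsets m))
    ≡⟨ count-++ p (map (inside ∷_) (allSubsets m)) _ ⟩
  count p (map (inside ∷_) (allSubsets m)) + count p (map (outside ∷_) (allSubsets m))
    ≡⟨ cong₂ _+_ (count-map p (inside ∷_) (allSubsets m)) (count-map p (outside ∷_) (allSubsets m)) ⟩
  count (p ∘ (inside ∷_)) (allSubsets m) + count (p ∘ (outside ∷_)) (allSubsets m) ∎

_∈[_,_]? : ∀ {m} (F A B : Subset m) → Dec (F ∈[ A , B ])
F ∈[ A , B ]? = A ⊆? F ×-dec F ⊆? B

∣q─p∣+∣p∣≡∣q∣ : ∀ {m} {p q : Subset m} → p ⊆ q → ∣ q ─ p ∣ + ∣ p ∣ ≡ ∣ q ∣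
∣q─p∣+∣p∣≡∣q∣ {p = []}          {[]}          _   = refl
∣q─p∣+∣p∣≡∣q∣ {p = inside ∷ p}  {inside ∷ q}  p⊆q =
  trans (ℕP.+-suc ∣ q ─ p ∣ ∣ p ∣) (cong suc (∣q─p∣+∣p∣≡∣q∣ (drop-∷-⊆ p⊆q)))
∣q─p∣+∣p∣≡∣q∣ {p = inside ∷ p}  {outside ∷ q} p⊆q with () ← p⊆q here
∣q─p∣+∣p∣≡∣q∣ {p = outside ∷ p} {inside ∷ q}  p⊆q = cong suc (∣q─p∣+∣p∣≡∣q∣ (drop-∷-⊆ p⊆q))
∣q─p∣+∣p∣≡∣q∣ {p = outside ∷ p} {outside ∷ q} p⊆q = ∣q─p∣+∣p∣≡∣q∣ (drop-∷-⊆ p⊆q)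

count-interval : ∀ {m} {A B : Subset m} → A ⊆ B → ∀ l →
  count (λ F → does (F ∈[ A , B ]?) ∧ (∣ F ∣ ≡ᵇ l)) (allSubsets m) ≡ shiftedBinom ∣ B ─ A ∣ ∣ A ∣ l
count-interval {A = []} {[]} _ zero    = refl
count-interval {A = []} {[]} _ (suc l) = refl
count-interval {suc m} {a ∷ A} {b ∷ B} a∷A⊆b∷B l =
  trans (count-allSubsets (λ F → does (F ∈[ a ∷ A , b ∷ B ]?) ∧ (∣ F ∣ ≡ᵇ l))) (by-first-element a b l a∷A⊆b∷B)
  where
  none : ∀ {p} → (∀ F → p F ≡ false) → count p (allSubsets m) ≡ 0
  none p≡false = count-none _ p≡false (allSubsets m)
  by-first-element : ∀ a b l → (a ∷ A) ⊆ (b ∷ B) →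
    let p = λ F → does (F ∈[ a ∷ A , b ∷ B ]?) ∧ (∣ F ∣ ≡ᵇ l) in
    count (p ∘ (inside ∷_)) (allSubsets m) + count (p ∘ (outside ∷_)) (allSubsets m)
      ≡ shiftedBinom ∣ (b ∷ B) ─ (a ∷ A) ∣ ∣ a ∷ A ∣ l
  by-first-element inside  outside l       a∷A⊆b∷B with () ← a∷A⊆b∷B here
  by-first-element inside  inside  zero    _ = cong₂ _+_ (none (λ F → ∧-zeroʳ _)) (none (λ _ → refl))
  by-first-element inside  inside  (suc l) a∷A⊆b∷B =
    trans (cong₂ _+_ (count-interval (drop-∷-⊆ a∷A⊆b∷B) l) (none (λ _ → refl))) (ℕP.+-identityʳ _)
  by-first-element outside inside  zero    a∷A⊆b∷B =
    trans (cong₂ _+_ (none (λ F → ∧-zeroʳ _)) (count-interval (drop-∷-⊆ a∷A⊆b∷B) zero))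
          (sym (shiftedBinom-zero ∣ B ─ A ∣ ∣ A ∣))
  by-first-element outside inside  (suc l) a∷A⊆b∷B =
    trans (cong₂ _+_ (count-interval (drop-∷-⊆ a∷A⊆b∷B) l) (count-interval (drop-∷-⊆ a∷A⊆b∷B) (suc l)))
          (sym (shiftedBinom-pascal ∣ B ─ A ∣ ∣ A ∣ l))
  by-first-element outside outside l       a∷A⊆b∷B =
    cong₂ _+_ (none (λ F → cong (_∧ (suc ∣ F ∣ ≡ᵇ l)) (∧-zeroʳ _))) (count-interval (drop-∷-⊆ a∷A⊆b∷B) l)

-- Sums over an interval partition

module Partition {m θ} {Φ : FaceSystem m} {A B : Fin θ → Subset m}
                 (partition : IntervalPartition Φ θ A B) where
  open IntervalPartition partition

  dim low : Fin θ → ℕ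
  dim k = ∣ B k ─ A k ∣
  low k = ∣ A k ∣

  dim+low≤m : ∀ k → dim k + low k ≤ m
  dim+low≤m k = subst (_≤ m) (sym (∣q─p∣+∣p∣≡∣q∣ (lower⊆upper k))) (∣p∣≤n (B k))

  profile≡∑δ : ∀ i j → + profile A B i j ≡ ∑[ k < θ ] (δ j (low k) * δ i (dim k))
  profile≡∑δ i j = begin
    + profile A B i j
      ≡⟨ count-tabulate (λ k → (dim k ≡ᵇ i) ∧ (low k ≡ᵇ j)) (λ k → k) ⟩
    ∑[ k < θ ] 𝟙 ((dim k ≡ᵇ i) ∧ (low k ≡ᵇ j))
      ≡⟨ sum-cong-≗ (λ k → trans (𝟙-∧ (dim k ≡ᵇ i) (low k ≡ᵇ j)) (ℤP.*-comm (δ (dim k) i) (δ (low k) j))) ⟩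
    ∑[ k < θ ] (δ (low k) j * δ (dim k) i)
      ≡⟨ sum-cong-≗ (λ k → cong₂ _*_ (δ-sym (low k) j) (δ-sym (dim k) i)) ⟩
    ∑[ k < θ ] (δ j (low k) * δ i (dim k)) ∎

  Σp≡∑ : ∀ g → Σp A B g ≡ ∑[ k < θ ] g (dim k) (low k)
  Σp≡∑ g = begin
    Σ≤ m (λ i → Σ≤ m (λ j → + profile A B i j * g i j))
      ≡⟨ Σ≤-cong m (λ i _ → Σ≤-cong m (λ j _ → distribute i j)) ⟩
    Σ≤ m (λ i → Σ≤ m (λ j → ∑[ k < θ ] (g i j * δ j (low k) * δ i (dim k))))
      ≡⟨ Σ≤-cong m (λ i _ → Σ≤-∑-comm m θ (λ j k → g i j * δ j (low k) * δ i (dim k))) ⟩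
    Σ≤ m (λ i → ∑[ k < θ ] Σ≤ m (λ j → g i j * δ j (low k) * δ i (dim k)))
      ≡⟨ Σ≤-∑-comm m θ (λ i k → Σ≤ m (λ j → g i j * δ j (low k) * δ i (dim k))) ⟩
    ∑[ k < θ ] Σ≤ m (λ i → Σ≤ m (λ j → g i j * δ j (low k) * δ i (dim k)))
      ≡⟨ sum-cong-≗ (λ k → Σ≤²-δ m g (ℕP.m+n≤o⇒m≤o (dim k) (dim+low≤m k)) (ℕP.m+n≤o⇒n≤o (dim k) (dim+low≤m k))) ⟩
    ∑[ k < θ ] g (dim k) (low k) ∎
    where
    rearrange : ∀ x a b → (a * b) * x ≡ x * a * b
    rearrange = solve-∀
    distribute : ∀ i j → + profile A B i j * g i j ≡ ∑[ k < θ ] (g i j * δ j (low k) * δ i (dim k))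
    distribute i j =
      trans (cong (_* g i j) (profile≡∑δ i j))
            (trans (*-distribʳ-sum (g i j) (λ k → δ j (low k) * δ i (dim k)))
                   (sum-cong-≗ (λ k → rearrange (g i j) (δ j (low k)) (δ i (dim k)))))

  𝟙-membership : ∀ F → 𝟙 (Φ F) ≡ ∑[ k < θ ] 𝟙 (does (F ∈[ A k , B k ]?))
  𝟙-membership F with Φ F in F∈Φ
  ... | true  = sym (∑-𝟙-unique (λ k → F ∈[ A k , B k ]?) (proj₂ (cover F F∈Φ))
                                (λ k F∈k → disjoint k _ F F∈k (proj₂ (cover F F∈Φ))))
  ... | false = sym (∑-𝟙-none (λ k → F ∈[ A k , B k ]?)
                              (λ k F∈k → true≢false (trans (sym (inside-Φ k F F∈k)) F∈Φ)))
    where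
    true≢false : true ≢ false
    true≢false ()

  fvec≡∑ : ∀ l → + fvec Φ l ≡ ∑[ k < θ ] fInterval (dim k) (low k) l
  fvec≡∑ l = begin
    + count (λ F → Φ F ∧ (∣ F ∣ ≡ᵇ l)) (allSubsets m)
      ≡⟨ count-∑ _ (λ k F → does (F ∈[ A k , B k ]?) ∧ (∣ F ∣ ≡ᵇ l)) split (allSubsets m) ⟩
    ∑[ k < θ ] (+ count (λ F → does (F ∈[ A k , B k ]?) ∧ (∣ F ∣ ≡ᵇ l)) (allSubsets m))
      ≡⟨ sum-cong-≗ (λ k → trans (cong +_ (count-interval (lower⊆upper k) l)) (sym (binomℤ-shift (dim k) (low k) l))) ⟩
    ∑[ k < θ ] fInterval (dim k) (low k) l ∎
    where
    split : ∀ F → 𝟙 (Φ F ∧ (∣ F ∣ ≡ᵇ l)) ≡ ∑[ k < θ ] 𝟙 (does (F ∈[ A k , B k ]?) ∧ (∣ F ∣ ≡ᵇ l))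
    split F = begin
      𝟙 (Φ F ∧ c)                                       ≡⟨ 𝟙-∧ (Φ F) c ⟩
      𝟙 (Φ F) * 𝟙 c                                     ≡⟨ cong (_* 𝟙 c) (𝟙-membership F) ⟩
      (∑[ k < θ ] 𝟙 (does (F ∈[ A k , B k ]?))) * 𝟙 c   ≡⟨ *-distribʳ-sum (𝟙 c) (λ k → 𝟙 (does (F ∈[ A k , B k ]?))) ⟩
      ∑[ k < θ ] (𝟙 (does (F ∈[ A k , B k ]?)) * 𝟙 c)   ≡⟨ sum-cong-≗ (λ k → 𝟙-∧ (does (F ∈[ A k , B k ]?)) c) ⟨
      ∑[ k < θ ] 𝟙 (does (F ∈[ A k , B k ]?) ∧ c)       ∎
      where c = ∣ F ∣ ≡ᵇ l

  fvec≡Q : ∀ l → + fvec Φ l ≡ Σp A B (λ i j → binomℤ (+ i) (+ l - + j))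
  fvec≡Q l = trans (fvec≡∑ l) (sym (Σp≡∑ _))

  profile-IsCoords : ∀ (b : ℕ → ℕ → ℤ) (σ : ℕ → ℤ) (G : ℕ → ℕ → ℕ → ℤ) →
    (∀ p q → p + q ≤ m → IsCoords m (fInterval p q) b (λ l → σ l * G l p q)) →
    IsCoords m (λ l → + fvec Φ l) b (λ l → σ l * Σp A B (G l))
  profile-IsCoords b σ G interval-coords j j≤m = begin
    Σ≤ m (λ l → σ l * Σp A B (G l) * b l j)
      ≡⟨ Σ≤-cong m (λ l _ → distribute l) ⟩
    Σ≤ m (λ l → ∑[ k < θ ] (σ l * G l (dim k) (low k) * b l j))
      ≡⟨ Σ≤-∑-comm m θ (λ l k → σ l * G l (dim k) (low k) * b l j) ⟩
    ∑[ k < θ ] Σ≤ m (λ l → σ l * G l (dim k) (low k) * b l j)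
      ≡⟨ sum-cong-≗ (λ k → interval-coords (dim k) (low k) (dim+low≤m k) j j≤m) ⟩
    ∑[ k < θ ] fInterval (dim k) (low k) j
      ≡⟨ fvec≡∑ j ⟨
    + fvec Φ j ∎
    where
    distribute : ∀ l → σ l * Σp A B (G l) * b l j ≡ ∑[ k < θ ] (σ l * G l (dim k) (low k) * b l j)
    distribute l = begin
      σ l * Σp A B (G l) * b l j                        ≡⟨ cong (λ x → σ l * x * b l j) (Σp≡∑ (G l)) ⟩
      σ l * (∑[ k < θ ] G l (dim k) (low k)) * b l j    ≡⟨ cong (_* b l j) (*-distribˡ-sum (σ l) (λ k → G l (dim k) (low k))) ⟩
      (∑[ k < θ ] (σ l * G l (dim k) (low k))) * b l j  ≡⟨ *-distribʳ-sum (b l j) (λ k → σ l * G l (dim k) (low k)) ⟩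
      ∑[ k < θ ] (σ l * G l (dim k) (low k) * b l j)    ∎

mainTheorem7 :
    (m : ℕ) → 1 ≤ m →
    (Φ : FaceSystem m) → (∃ λ F → F ∈Φ Φ) →
    (θ : ℕ) → (A B : Fin θ → Subset m) → IntervalPartition Φ θ A B →
    let f : ℕ → ℤ
        f l = + fvec Φ l
        P : (ℕ → ℕ → ℤ) → ℤ
        P g = Σp A B g
        Q : ℕ → ℤ
        Q s = P (λ i j → binomℤ (+ i) (+ s - + j))
    in
    (∀ l → l ≤ m → f l ≡ Q l)
    × IsCoords m f (Hbullet m)
        (λ l → Σ≤ m (λ s → + binom (m ∸ s) (m ∸ l) * Q s))
    × IsCoords m f (Ftri m)
        (λ l → sgn l * P (λ i j → sgn (i + j) * binomℤ (+ j) (+ l - + i)))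
    × IsCoords m f (Htri m)
        (λ l → sgn (m ∸ l) * Σ≤ m (λ s → + binom s (m ∸ l) * Q s))
    × IsCoords m f (Ftriv m)
        (λ l → sgn (m ∸ l) * P (λ i j → sgn j * binomℤ (+ m - + i - + j) (+ l - + i)))
    × IsCoords m f (Htriv m)
        (λ l → P (λ i j → binomℤ (+ i) (+ m - + l - + j)))
mainTheorem7 m _ Φ _ θ A B partition =
    (λ l _ → fvec≡Q l)
  , IsCoords-cong (Hbullet m) (λ l _ → Σ≤-cong m (λ s _ → cong (+ binom (m ∸ s) (m ∸ l) *_) (fvec≡Q s)))
      (leftInverse⇒IsCoords f (Hbullet m) (λ s l → + binom (m ∸ s) (m ∸ l)) (λ _ _ → Hbullet-leftInverse))
  , profile-IsCoords (Ftri m) sgn _ (λ _ _ → Ftri-interval)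
  , IsCoords-cong (Htri m) pull-sign
      (leftInverse⇒IsCoords f (Htri m) (λ s l → sgn (m ∸ l) * + binom s (m ∸ l)) (λ _ _ s≤m _ → Htri-leftInverse s≤m))
  , profile-IsCoords (Ftriv m) (λ l → sgn (m ∸ l)) _ (λ _ _ → Ftriv-interval)
  , IsCoords-cong (Htriv m) reversed-Q (reversed-IsCoords m f)
  where
  open Partition partition
  f : ℕ → ℤ
  f l = + fvec Φ l
  pull-sign : ∀ l → l ≤ m → Σ≤ m (λ s → sgn (m ∸ l) * + binom s (m ∸ l) * f s)
                          ≡ sgn (m ∸ l) * Σ≤ m (λ s → + binom s (m ∸ l) * Σp A B (λ i j → binomℤ (+ i) (+ s - + j)))
  pull-sign l _ = trans (Σ≤-cong m (λ s _ → trans (ℤP.*-assoc (sgn (m ∸ l)) _ (f s))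
                                                 (cong (λ x → sgn (m ∸ l) * (+ binom s (m ∸ l) * x)) (fvec≡Q s))))
                        (Σ≤-*ˡ m (sgn (m ∸ l)) _)
  reversed-Q : ∀ l → l ≤ m → f (m ∸ l) ≡ Σp A B (λ i j → binomℤ (+ i) (+ m - + l - + j))
  reversed-Q l l≤m = trans (fvec≡Q (m ∸ l)) (cong (λ x → Σp A B (λ i j → binomℤ (+ i) (x - + j))) (sym (pos-∸ l≤m)))
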